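{- Let $r,s,n\in\mathbb N=\{1,2,3,\dots\}$ and let $\ell$ be an integer with $0\le \ell\le n$. Then $$ \binom{\ell+r-1}{r-1}\binom{n-\ell+s-1}{s-1}\sum_{j=1}^{s-1}\frac{1}{n-\ell+j}=\sum_{t=0}^{r+s-3}a_{1}(r,s,n,t)\,\ell^t, $$ where $$ a_{1}(r,s,n,t)=\frac{1}{(r-1)!\,(s-1)!}\sum_{\substack{t_{1}+t_{2}=t\\ 0 \le t_{1} \le r-1\\ 0 \le t_{2} \le s-2 }} s_{u}(r,t_{1}+1) \sum_{k_{2}=t_{2}}^{s-2} s_{u}(s,k_{2}+2)\, (k_{2}+1) \binom{k_{2}}{t_{2}} (-1)^{t_{2}} n^{k_{2}-t_{2}}. $$
   Context: $s_u(n,k)$ denotes the unsigned Stirling numbers of the first kind, defined by $x(x+1)\cdots(x+n-1)=\sum_{k=0}^n s_u(n,k)x^k$ (with the empty product equal to $1$). An empty sum equals $0$ (so the sum $\sum_{j=1}^{s-1}$ is $0$ when $s=1$). The convention $0^0=1$ is used. -}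

module Defs where

open import Data.Nat as ℕ using (ℕ; zero; suc; _∸_; _≟_)
open import Data.Nat.Combinatorics using (_C_)
open import Data.Integer using (ℤ; +_; -[1+_])
open import Data.Rational using (ℚ; _/_; 0ℚ; 1ℚ; _+_; _*_)
open import Data.List using (List; []; _∷_)
open import Relation.Nullary using (yes; no)

-- Polynomials with ℕ coefficients as coefficient lists (lowest degree first).
addP : List ℕ → List ℕ → List ℕ
addP [] q = q
addP (a ∷ p) [] = a ∷ p
addP (a ∷ p) (b ∷ q) = (a ℕ.+ b) ∷ addP p q

scaleP : ℕ → List ℕ → List ℕ
scaleP m [] = []
scaleP m (a ∷ p) = (m ℕ.* a) ∷ scaleP m p

mulLin : ℕ → List ℕ → List ℕ
mulLin m p = addP (0 ∷ p) (scaleP m p)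

rising : ℕ → List ℕ
rising zero = 1 ∷ []
rising (suc n) = mulLin n (rising n)

coeff : List ℕ → ℕ → ℕ
coeff [] k = 0
coeff (a ∷ p) zero = a
coeff (a ∷ p) (suc k) = coeff p k

-- unsigned Stirling numbers of the first kind: coefficient of x^k in x(x+1)...(x+n-1)
su : ℕ → ℕ → ℕ
su n k = coeff (rising n) k

ℕtoℚ : ℕ → ℚ
ℕtoℚ m = (+ m) / 1

ℤtoℚ : ℤ → ℚ
ℤtoℚ z = z / 1

-- reciprocal of a natural number (only applied to nonzero arguments)
inv : ℕ → ℚ
inv zero = 0ℚ
inv (suc m) = (+ 1) / suc m

negOnePow : ℕ → ℚ
negOnePow zero = 1ℚ
negOnePow (suc t) = ℤtoℚ -[1+ 0 ] * negOnePow t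

sumTo : ℕ → (ℕ → ℚ) → ℚ
sumTo zero f = 0ℚ
sumTo (suc m) f = sumTo m f + f m

-- Σ_{a ≤ i < b} f i  (empty if b ≤ a)
sumRange : ℕ → ℕ → (ℕ → ℚ) → ℚ
sumRange a b f = sumTo (b ∸ a) (λ i → f (a ℕ.+ i))

ifEq : ℕ → ℕ → ℚ → ℚ
ifEq m k q with m ≟ k
... | yes _ = q
... | no _ = 0ℚ

a1 : ℕ → ℕ → ℕ → ℕ → ℚ
a1 r s n t =
  inv (ℕ._! (r ∸ 1) ℕ.* ℕ._! (s ∸ 1)) *
  sumRange 0 r (λ t₁ → sumRange 0 (s ∸ 1) (λ t₂ → ifEq (t₁ ℕ.+ t₂) t (
    ℕtoℚ (su r (t₁ ℕ.+ 1)) *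
    sumRange t₂ (s ∸ 1) (λ k₂ →
      ℕtoℚ (su s (k₂ ℕ.+ 2)) * ℕtoℚ (k₂ ℕ.+ 1) * ℕtoℚ (k₂ C t₂) *
      negOnePow t₂ * ℕtoℚ (n ℕ.^ (k₂ ∸ t₂))))))

module Submission where

-- Write m = n − ℓ.  By the definition of s_u, the polynomial P_r(x) = Σ_t s_u(r, t+1) x^t
-- equals (x+1)(x+2)⋯(x+r−1), so P_r(ℓ) = C(ℓ+r−1, r−1)·(r−1)!, and logarithmic
-- differentiation gives P_s′(m) = P_s(m) · Σ_{j=1}^{s−1} 1/(m+j).  The right-hand side is
-- 1/((r−1)!(s−1)!) times the product P_r(ℓ) · Q(ℓ), the constraint t₁ + t₂ = t picking out the
-- coefficient of ℓ^t; exchanging the sums over t₂ and k₂ and applying the binomial theorem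
-- to (n − ℓ)^{k₂} shows Q(ℓ) = Σ_k s_u(s, k+2)(k+1) m^k = P_s′(m).

open import Defs
open import Data.Nat using (ℕ; _≤_; _∸_)
open import Data.Nat.Combinatorics using (_C_)
open import Data.Rational using (ℚ; _*_)
open import Relation.Binary.PropositionalEquality using (_≡_)

open import Algebra.Bundles using (CommutativeMonoid; CommutativeRing; Semiring)
open import Data.Empty using (⊥-elim)
open import Data.Fin using (toℕ)
import Data.Integer as ℤ
import Data.Integer.Properties as ℤP
open import Data.List using ([]; _∷_)
open import Data.Nat as ℕ using (zero; suc; _<_; _!; NonZero)
import Data.Nat.Combinatorics as ℕC
open import Data.Nat.DivMod using (_/_; m/n*n≡m)
import Data.Nat.Properties as ℕP
open import Data.Rational as ℚ using (_+_; -_; 0ℚ; 1ℚ)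
import Data.Rational.Properties as ℚP
open import Data.Rational.Solver using (module +-*-Solver)
import Data.Rational.Unnormalised as ℚᵘ
import Data.Rational.Unnormalised.Properties as ℚᵘP
open import Data.Sum using (inj₁; inj₂)
open import Function using (_∘_)
open import Level using (0ℓ)
open import Relation.Binary.PropositionalEquality
  using (refl; sym; trans; cong; cong₂; subst; module ≡-Reasoning)
open import Relation.Nullary using (yes; no; ¬_)

private
  ℚ-semiring : Semiring 0ℓ 0ℓ
  ℚ-semiring = CommutativeRing.semiring ℚP.+-*-commutativeRing

open import Algebra.Properties.CommutativeSemigroup
  (CommutativeMonoid.commutativeSemigroup ℚP.+-0-commutativeMonoid) using (interchange)
open import Algebra.Properties.Semiring.Mult ℚ-semiring using (_×_; ×-homo-+; ×1-homo-*; ×-assoc-*)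
open import Algebra.Properties.Semiring.Exp ℚ-semiring using (_^_; ^-homo-*)
open import Algebra.Properties.Semiring.Sum ℚ-semiring using (sum)
open import Algebra.Properties.CommutativeSemiring.Binomial
  (CommutativeRing.commutativeSemiring ℚP.+-*-commutativeRing) using (theorem; binomialExpansion)

sumTo-cong : ∀ m {f g : ℕ → ℚ} → (∀ i → i < m → f i ≡ g i) → sumTo m f ≡ sumTo m g
sumTo-cong zero    f≗g = refl
sumTo-cong (suc m) f≗g =
  cong₂ _+_ (sumTo-cong m (λ i i<m → f≗g i (ℕP.m<n⇒m<1+n i<m))) (f≗g m (ℕP.n<1+n m))

sumTo-zero : ∀ m {f : ℕ → ℚ} → (∀ i → i < m → f i ≡ 0ℚ) → sumTo m f ≡ 0ℚ
sumTo-zero zero    f≗0 = refl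
sumTo-zero (suc m) f≗0 =
  cong₂ _+_ (sumTo-zero m (λ i i<m → f≗0 i (ℕP.m<n⇒m<1+n i<m))) (f≗0 m (ℕP.n<1+n m))

sumTo-+ : ∀ m (f g : ℕ → ℚ) → sumTo m (λ i → f i + g i) ≡ sumTo m f + sumTo m g
sumTo-+ zero    f g = refl
sumTo-+ (suc m) f g =
  trans (cong (_+ (f m + g m)) (sumTo-+ m f g)) (interchange (sumTo m f) (sumTo m g) (f m) (g m))

sumTo-*ˡ : ∀ m c (f : ℕ → ℚ) → c * sumTo m f ≡ sumTo m (λ i → c * f i)
sumTo-*ˡ zero    c f = ℚP.*-zeroʳ c
sumTo-*ˡ (suc m) c f = trans (ℚP.*-distribˡ-+ c (sumTo m f) (f m)) (cong (_+ c * f m) (sumTo-*ˡ m c f))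

sumTo-*ʳ : ∀ m (f : ℕ → ℚ) c → sumTo m f * c ≡ sumTo m (λ i → f i * c)
sumTo-*ʳ zero    f c = ℚP.*-zeroˡ c
sumTo-*ʳ (suc m) f c = trans (ℚP.*-distribʳ-+ c (sumTo m f) (f m)) (cong (_+ f m * c) (sumTo-*ʳ m f c))

sumTo-sucˡ : ∀ m (f : ℕ → ℚ) → sumTo (suc m) f ≡ f 0 + sumTo m (f ∘ suc)
sumTo-sucˡ zero    f = trans (ℚP.+-identityˡ (f 0)) (sym (ℚP.+-identityʳ (f 0)))
sumTo-sucˡ (suc m) f = trans (cong (_+ f (suc m)) (sumTo-sucˡ m f)) (ℚP.+-assoc (f 0) _ _)

sumTo-head-vanishes : ∀ m {f : ℕ → ℚ} → f 0 ≡ 0ℚ → sumTo (suc m) f ≡ sumTo m (f ∘ suc)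
sumTo-head-vanishes m {f} f0≡0 =
  trans (sumTo-sucˡ m f) (trans (cong (_+ sumTo m (f ∘ suc)) f0≡0) (ℚP.+-identityˡ _))

sumTo-last-vanishes : ∀ m {f : ℕ → ℚ} → f m ≡ 0ℚ → sumTo (suc m) f ≡ sumTo m f
sumTo-last-vanishes m {f} fm≡0 = trans (cong (sumTo m f +_) fm≡0) (ℚP.+-identityʳ _)

sumTo-comm : ∀ a b (f : ℕ → ℕ → ℚ) →
  sumTo a (λ i → sumTo b (f i)) ≡ sumTo b (λ j → sumTo a (λ i → f i j))
sumTo-comm zero    b f = sym (sumTo-zero b (λ _ _ → refl))
sumTo-comm (suc a) b f =
  trans (cong (_+ sumTo b (f a)) (sumTo-comm a b f)) (sym (sumTo-+ b (λ j → sumTo a (λ i → f i j)) (f a)))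

sumTo-*-sumTo : ∀ a b (f g : ℕ → ℚ) →
  sumTo a f * sumTo b g ≡ sumTo a (λ i → sumTo b (λ j → f i * g j))
sumTo-*-sumTo a b f g = trans (sumTo-*ʳ a f (sumTo b g)) (sumTo-cong a (λ i _ → sumTo-*ˡ b (f i) g))

sumTo≡sum : ∀ m (f : ℕ → ℚ) → sumTo m f ≡ sum {m} (f ∘ toℕ)
sumTo≡sum zero    f = refl
sumTo≡sum (suc m) f = trans (sumTo-sucˡ m f) (cong (f 0 +_) (sumTo≡sum m (f ∘ suc)))

sumRange-suc : ∀ t M (h : ℕ → ℚ) → t ≤ M → sumRange t (suc M) h ≡ sumRange t M h + h M
sumRange-suc t M h t≤M = begin
  sumTo (suc M ∸ t) (λ i → h (t ℕ.+ i))
    ≡⟨ cong (λ k → sumTo k (λ i → h (t ℕ.+ i))) (ℕP.+-∸-assoc 1 t≤M) ⟩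
  sumRange t M h + h (t ℕ.+ (M ∸ t))
    ≡⟨ cong (λ k → sumRange t M h + h k) (ℕP.m+[n∸m]≡n t≤M) ⟩
  sumRange t M h + h M ∎
  where open ≡-Reasoning

sumRange-empty : ∀ M (h : ℕ → ℚ) → sumRange M M h ≡ 0ℚ
sumRange-empty M h = cong (λ k → sumTo k (λ i → h (M ℕ.+ i))) (ℕP.n∸n≡0 M)

sumTo-sumRange-comm : ∀ M (g : ℕ → ℕ → ℚ) →
  sumTo M (λ t → sumRange t M (λ k → g k t)) ≡ sumTo M (λ k → sumTo (suc k) (g k))
sumTo-sumRange-comm zero    g = refl
sumTo-sumRange-comm (suc M) g = begin
  sumTo M (λ t → sumRange t (suc M) (λ k → g k t)) + sumRange M (suc M) (λ k → g k M)
    ≡⟨ cong₂ _+_ (sumTo-cong M (λ t t<M → sumRange-suc t M (λ k → g k t) (ℕP.<⇒≤ t<M))) lastColumn ⟩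
  sumTo M (λ t → sumRange t M (λ k → g k t) + g M t) + g M M
    ≡⟨ cong (_+ g M M) (sumTo-+ M _ (g M)) ⟩
  (sumTo M (λ t → sumRange t M (λ k → g k t)) + sumTo M (g M)) + g M M
    ≡⟨ cong (λ z → (z + sumTo M (g M)) + g M M) (sumTo-sumRange-comm M g) ⟩
  (sumTo M (λ k → sumTo (suc k) (g k)) + sumTo M (g M)) + g M M
    ≡⟨ ℚP.+-assoc (sumTo M (λ k → sumTo (suc k) (g k))) (sumTo M (g M)) (g M M) ⟩
  sumTo M (λ k → sumTo (suc k) (g k)) + sumTo (suc M) (g M) ∎
  where
  open ≡-Reasoning
  lastColumn : sumRange M (suc M) (λ k → g k M) ≡ g M M
  lastColumn = trans (sumRange-suc M M (λ k → g k M) ℕP.≤-refl)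
                     (trans (cong (_+ g M M) (sumRange-empty M (λ k → g k M))) (ℚP.+-identityˡ (g M M)))

ifEq-refl : ∀ m q → ifEq m m q ≡ q
ifEq-refl m q with m ℕ.≟ m
... | yes _   = refl
... | no m≢m = ⊥-elim (m≢m refl)

ifEq-≢ : ∀ {m k} q → ¬ m ≡ k → ifEq m k q ≡ 0ℚ
ifEq-≢ {m} {k} q m≢k with m ℕ.≟ k
... | yes m≡k = ⊥-elim (m≢k m≡k)
... | no _    = refl

sumTo-ifEq : ∀ N {m} q (y : ℕ → ℚ) → m < N → sumTo N (λ t → ifEq m t q * y t) ≡ q * y m
sumTo-ifEq (suc N) {m} q y m<1+N with ℕP.m<1+n⇒m<n∨m≡n m<1+N
... | inj₁ m<N = begin
  sumTo N (λ t → ifEq m t q * y t) + ifEq m N q * y N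
    ≡⟨ cong₂ _+_ (sumTo-ifEq N q y m<N) (cong (_* y N) (ifEq-≢ q (ℕP.<⇒≢ m<N))) ⟩
  q * y m + 0ℚ * y N
    ≡⟨ trans (cong (q * y m +_) (ℚP.*-zeroˡ (y N))) (ℚP.+-identityʳ (q * y m)) ⟩
  q * y m ∎
  where open ≡-Reasoning
... | inj₂ refl = begin
  sumTo N (λ t → ifEq N t q * y t) + ifEq N N q * y N
    ≡⟨ cong₂ _+_ (sumTo-zero N vanish) (cong (_* y N) (ifEq-refl N q)) ⟩
  0ℚ + q * y N
    ≡⟨ ℚP.+-identityˡ (q * y N) ⟩
  q * y N ∎
  where
  open ≡-Reasoning
  vanish : ∀ t → t < N → ifEq N t q * y t ≡ 0ℚ
  vanish t t<N = trans (cong (_* y t) (ifEq-≢ q (ℕP.<⇒≢ t<N ∘ sym))) (ℚP.*-zeroˡ (y t))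

sumTo-convolution : ∀ N a b (f g : ℕ → ℚ) x → (∀ i j → i < a → j < b → i ℕ.+ j < N) →
  sumTo N (λ t → sumTo a (λ i → sumTo b (λ j → ifEq (i ℕ.+ j) t (f i * g j))) * x ^ t)
  ≡ sumTo a (λ i → f i * x ^ i) * sumTo b (λ j → g j * x ^ j)
sumTo-convolution N a b f g x i+j<N = begin
  sumTo N (λ t → sumTo a (λ i → sumTo b (λ j → c i j t)) * x ^ t)
    ≡⟨ sumTo-cong N (λ t _ → trans (sumTo-*ʳ a _ (x ^ t))
                                   (sumTo-cong a (λ i _ → sumTo-*ʳ b (λ j → c i j t) (x ^ t)))) ⟩
  sumTo N (λ t → sumTo a (λ i → sumTo b (λ j → c i j t * x ^ t)))
    ≡⟨ sumTo-comm N a _ ⟩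
  sumTo a (λ i → sumTo N (λ t → sumTo b (λ j → c i j t * x ^ t)))
    ≡⟨ sumTo-cong a (λ i _ → sumTo-comm N b _) ⟩
  sumTo a (λ i → sumTo b (λ j → sumTo N (λ t → c i j t * x ^ t)))
    ≡⟨ sumTo-cong a (λ i i<a → sumTo-cong b (λ j j<b → sumTo-ifEq N (f i * g j) (x ^_) (i+j<N i j i<a j<b))) ⟩
  sumTo a (λ i → sumTo b (λ j → (f i * g j) * x ^ (i ℕ.+ j)))
    ≡⟨ sumTo-cong a (λ i _ → sumTo-cong b (λ j _ → separate i j)) ⟩
  sumTo a (λ i → sumTo b (λ j → (f i * x ^ i) * (g j * x ^ j)))
    ≡⟨ sumTo-*-sumTo a b _ _ ⟨
  sumTo a (λ i → f i * x ^ i) * sumTo b (λ j → g j * x ^ j) ∎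
  where
  open ≡-Reasoning
  c : ℕ → ℕ → ℕ → ℚ
  c i j t = ifEq (i ℕ.+ j) t (f i * g j)
  separate : ∀ i j → (f i * g j) * x ^ (i ℕ.+ j) ≡ (f i * x ^ i) * (g j * x ^ j)
  separate i j = trans (cong (f i * g j *_) (^-homo-* x i j)) (swap (f i) (g j) (x ^ i) (x ^ j))
    where
    open +-*-Solver
    swap : ∀ a b p q → (a * b) * (p * q) ≡ (a * p) * (b * q)
    swap = solve 4 (λ a b p q → (a :* b) :* (p :* q) := (a :* p) :* (b :* q)) refl

-- ℕtoℚ m is the normalisation of m/1, so its arithmetic is computed on unnormalised rationals.
private
  toℚᵘ-ℕtoℚ : ∀ m → ℚ.toℚᵘ (ℕtoℚ m) ℚᵘ.≃ ℚᵘ.mkℚᵘ (ℤ.+ m) 0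
  toℚᵘ-ℕtoℚ m = ℚP.toℚᵘ-fromℚᵘ (ℚᵘ.mkℚᵘ (ℤ.+ m) 0)

ℕtoℚ-suc : ∀ n → ℕtoℚ (suc n) ≡ 1ℚ + ℕtoℚ n
ℕtoℚ-suc n = ℚP.toℚᵘ-injective (begin
  ℚ.toℚᵘ (ℕtoℚ (suc n))              ≈⟨ toℚᵘ-ℕtoℚ (suc n) ⟩
  ℚᵘ.mkℚᵘ (ℤ.+ suc n) 0               ≈⟨ ℚᵘ.*≡* (cong (ℤ._* ℤ.+ 1) eq) ⟩
  ℚᵘ.1ℚᵘ ℚᵘ.+ ℚᵘ.mkℚᵘ (ℤ.+ n) 0       ≈⟨ ℚᵘP.+-congʳ ℚᵘ.1ℚᵘ (toℚᵘ-ℕtoℚ n) ⟨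
  ℚᵘ.1ℚᵘ ℚᵘ.+ ℚ.toℚᵘ (ℕtoℚ n)        ≈⟨ ℚP.toℚᵘ-homo-+ 1ℚ (ℕtoℚ n) ⟨
  ℚ.toℚᵘ (1ℚ + ℕtoℚ n)                ∎)
  where
  open ℚᵘP.≃-Reasoning
  eq : ℤ.+ suc n ≡ ℤ.+ 1 ℤ.+ ℤ.+ n ℤ.* ℤ.+ 1
  eq = sym (cong (ℤ._+_ (ℤ.+ 1)) (ℤP.*-identityʳ (ℤ.+ n)))

ℕtoℚ≡×1 : ∀ n → ℕtoℚ n ≡ n × 1ℚ
ℕtoℚ≡×1 zero    = refl
ℕtoℚ≡×1 (suc n) = trans (ℕtoℚ-suc n) (cong (1ℚ +_) (ℕtoℚ≡×1 n))

ℕtoℚ-+ : ∀ a b → ℕtoℚ (a ℕ.+ b) ≡ ℕtoℚ a + ℕtoℚ b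
ℕtoℚ-+ a b = begin
  ℕtoℚ (a ℕ.+ b)         ≡⟨ ℕtoℚ≡×1 (a ℕ.+ b) ⟩
  (a ℕ.+ b) × 1ℚ         ≡⟨ ×-homo-+ 1ℚ a b ⟩
  a × 1ℚ + b × 1ℚ        ≡⟨ cong₂ _+_ (ℕtoℚ≡×1 a) (ℕtoℚ≡×1 b) ⟨
  ℕtoℚ a + ℕtoℚ b        ∎
  where open ≡-Reasoning

ℕtoℚ-* : ∀ a b → ℕtoℚ (a ℕ.* b) ≡ ℕtoℚ a * ℕtoℚ b
ℕtoℚ-* a b = begin
  ℕtoℚ (a ℕ.* b)         ≡⟨ ℕtoℚ≡×1 (a ℕ.* b) ⟩
  (a ℕ.* b) × 1ℚ         ≡⟨ ×1-homo-* a b ⟩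
  (a × 1ℚ) * (b × 1ℚ)    ≡⟨ cong₂ _*_ (ℕtoℚ≡×1 a) (ℕtoℚ≡×1 b) ⟨
  ℕtoℚ a * ℕtoℚ b        ∎
  where open ≡-Reasoning

×≡ℕtoℚ* : ∀ n x → n × x ≡ ℕtoℚ n * x
×≡ℕtoℚ* n x = begin
  n × x                  ≡⟨ cong (n ×_) (ℚP.*-identityˡ x) ⟨
  n × (1ℚ * x)           ≡⟨ ×-assoc-* n 1ℚ x ⟨
  (n × 1ℚ) * x           ≡⟨ cong (_* x) (ℕtoℚ≡×1 n) ⟨
  ℕtoℚ n * x             ∎
  where open ≡-Reasoning

ℕtoℚ-^ : ∀ a k → ℕtoℚ (a ℕ.^ k) ≡ ℕtoℚ a ^ k
ℕtoℚ-^ a zero    = refl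
ℕtoℚ-^ a (suc k) = trans (ℕtoℚ-* a (a ℕ.^ k)) (cong (ℕtoℚ a *_) (ℕtoℚ-^ a k))

ℕtoℚ-∸ : ∀ {l n} → l ≤ n → - ℕtoℚ l + ℕtoℚ n ≡ ℕtoℚ (n ∸ l)
ℕtoℚ-∸ {l} {n} l≤n = begin
  - ℕtoℚ l + ℕtoℚ n
    ≡⟨ cong (λ k → - ℕtoℚ l + ℕtoℚ k) (ℕP.m+[n∸m]≡n l≤n) ⟨
  - ℕtoℚ l + ℕtoℚ (l ℕ.+ (n ∸ l))
    ≡⟨ cong (- ℕtoℚ l +_) (ℕtoℚ-+ l (n ∸ l)) ⟩
  - ℕtoℚ l + (ℕtoℚ l + ℕtoℚ (n ∸ l))
    ≡⟨ cancel (ℕtoℚ l) (ℕtoℚ (n ∸ l)) ⟩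
  ℕtoℚ (n ∸ l) ∎
  where
  open ≡-Reasoning
  open +-*-Solver
  cancel : ∀ a d → - a + (a + d) ≡ d
  cancel = solve 2 (λ a d → :- a :+ (a :+ d) := d) refl

inv-*-ℕtoℚ : ∀ m .{{_ : NonZero m}} → inv m * ℕtoℚ m ≡ 1ℚ
inv-*-ℕtoℚ (suc m) = ℚP.toℚᵘ-injective (begin
  ℚ.toℚᵘ (inv (suc m) * ℕtoℚ (suc m))
    ≈⟨ ℚP.toℚᵘ-homo-* (inv (suc m)) (ℕtoℚ (suc m)) ⟩
  ℚ.toℚᵘ (inv (suc m)) ℚᵘ.* ℚ.toℚᵘ (ℕtoℚ (suc m))
    ≈⟨ ℚᵘP.*-cong (ℚP.toℚᵘ-fromℚᵘ (ℚᵘ.mkℚᵘ (ℤ.+ 1) m)) (toℚᵘ-ℕtoℚ (suc m)) ⟩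
  ℚᵘ.mkℚᵘ (ℤ.+ 1) m ℚᵘ.* ℚᵘ.mkℚᵘ (ℤ.+ suc m) 0
    ≈⟨ ℚᵘ.*≡* eq ⟩
  ℚᵘ.1ℚᵘ ∎)
  where
  open ℚᵘP.≃-Reasoning
  eq : (ℤ.+ 1 ℤ.* ℤ.+ suc m) ℤ.* ℤ.+ 1 ≡ ℤ.+ 1 ℤ.* ℤ.+ (suc m ℕ.* 1)
  eq = trans (ℤP.*-identityʳ _) (cong (ℤ._*_ (ℤ.+ 1)) (cong ℤ.+_ (sym (ℕP.*-identityʳ (suc m)))))

*-cancelʳ-ℕtoℚ : ∀ m .{{_ : NonZero m}} {x y} → x * ℕtoℚ m ≡ y * ℕtoℚ m → x ≡ y
*-cancelʳ-ℕtoℚ m {x} {y} xm≡ym = begin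
  x                        ≡⟨ ℚP.*-identityʳ x ⟨
  x * 1ℚ                   ≡⟨ cong (x *_) m*m⁻¹≡1 ⟨
  x * (ℕtoℚ m * inv m)     ≡⟨ ℚP.*-assoc x _ _ ⟨
  x * ℕtoℚ m * inv m       ≡⟨ cong (_* inv m) xm≡ym ⟩
  y * ℕtoℚ m * inv m       ≡⟨ ℚP.*-assoc y _ _ ⟩
  y * (ℕtoℚ m * inv m)     ≡⟨ cong (y *_) m*m⁻¹≡1 ⟩
  y * 1ℚ                   ≡⟨ ℚP.*-identityʳ y ⟩
  y                        ∎
  where
  open ≡-Reasoning
  m*m⁻¹≡1 : ℕtoℚ m * inv m ≡ 1ℚ
  m*m⁻¹≡1 = trans (ℚP.*-comm (ℕtoℚ m) (inv m)) (inv-*-ℕtoℚ m)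

inv-*-cancel : ∀ a b .{{_ : NonZero (a ℕ.* b)}} x y h →
  inv (a ℕ.* b) * ((x * ℕtoℚ a) * ((y * ℕtoℚ b) * h)) ≡ x * y * h
inv-*-cancel a b x y h = begin
  inv (a ℕ.* b) * ((x * ℕtoℚ a) * ((y * ℕtoℚ b) * h))
    ≡⟨ regroup (inv (a ℕ.* b)) x (ℕtoℚ a) y (ℕtoℚ b) h ⟩
  (inv (a ℕ.* b) * (ℕtoℚ a * ℕtoℚ b)) * (x * y * h)
    ≡⟨ cong (λ z → (inv (a ℕ.* b) * z) * (x * y * h)) (ℕtoℚ-* a b) ⟨
  (inv (a ℕ.* b) * ℕtoℚ (a ℕ.* b)) * (x * y * h)
    ≡⟨ cong (_* (x * y * h)) (inv-*-ℕtoℚ (a ℕ.* b)) ⟩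
  1ℚ * (x * y * h)
    ≡⟨ ℚP.*-identityˡ (x * y * h) ⟩
  x * y * h ∎
  where
  open ≡-Reasoning
  open +-*-Solver
  regroup : ∀ c x a y b h → c * ((x * a) * ((y * b) * h)) ≡ (c * (a * b)) * (x * y * h)
  regroup = solve 6 (λ c x a y b h → c :* ((x :* a) :* ((y :* b) :* h)) := (c :* (a :* b)) :* (x :* y :* h)) refl

negOnePow-*-^ : ∀ j x → negOnePow j * x ^ j ≡ (- x) ^ j
negOnePow-*-^ zero    x = refl
negOnePow-*-^ (suc j) x =
  trans (rearrange (negOnePow j) x (x ^ j)) (cong (- x *_) (negOnePow-*-^ j x))
  where
  open +-*-Solver
  rearrange : ∀ ν x p → (- 1ℚ * ν) * (x * p) ≡ - x * (ν * p)
  rearrange = solve 3 (λ ν x p → (:- con 1ℚ :* ν) :* (x :* p) := :- x :* (ν :* p)) refl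

binomial : ∀ k x y → sumTo (suc k) (λ j → ℕtoℚ (k C j) * (x ^ j * y ^ (k ∸ j))) ≡ (x + y) ^ k
binomial k x y = begin
  sumTo (suc k) (λ j → ℕtoℚ (k C j) * (x ^ j * y ^ (k ∸ j)))
    ≡⟨ sumTo-cong (suc k) (λ j _ → ×≡ℕtoℚ* (k C j) _) ⟨
  sumTo (suc k) (λ j → (k C j) × (x ^ j * y ^ (k ∸ j)))
    ≡⟨ sumTo≡sum (suc k) _ ⟩
  binomialExpansion x y k
    ≡⟨ theorem k x y ⟨
  (x + y) ^ k ∎
  where open ≡-Reasoning

coeff-addP : ∀ p q k → coeff (addP p q) k ≡ coeff p k ℕ.+ coeff q k
coeff-addP []      q       k       = refl
coeff-addP (a ∷ p) []      k       = sym (ℕP.+-identityʳ _)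
coeff-addP (a ∷ p) (b ∷ q) zero    = refl
coeff-addP (a ∷ p) (b ∷ q) (suc k) = coeff-addP p q k

coeff-scaleP : ∀ m p k → coeff (scaleP m p) k ≡ m ℕ.* coeff p k
coeff-scaleP m []      k       = sym (ℕP.*-zeroʳ m)
coeff-scaleP m (a ∷ p) zero    = refl
coeff-scaleP m (a ∷ p) (suc k) = coeff-scaleP m p k

su-suc-suc : ∀ n k → su (suc n) (suc k) ≡ su n k ℕ.+ n ℕ.* su n (suc k)
su-suc-suc n k = trans (coeff-addP (0 ∷ rising n) (scaleP n (rising n)) (suc k))
                       (cong (su n k ℕ.+_) (coeff-scaleP n (rising n) (suc k)))

su-suc-zero : ∀ n → su (suc n) 0 ≡ 0
su-suc-zero n = trans (coeff-addP (0 ∷ rising n) (scaleP n (rising n)) 0)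
                (trans (coeff-scaleP n (rising n) 0) (n*su[n,0]≡0 n))
  where
  n*su[n,0]≡0 : ∀ n → n ℕ.* su n 0 ≡ 0
  n*su[n,0]≡0 zero    = refl
  n*su[n,0]≡0 (suc n) = trans (cong (suc n ℕ.*_) (su-suc-zero n)) (ℕP.*-zeroʳ (suc n))

su-vanishes : ∀ {n k} → n < k → su n k ≡ 0
su-vanishes {zero}  {suc k} _ = refl
su-vanishes {suc n} {suc k} (ℕ.s≤s n<k) = begin
  su (suc n) (suc k)
    ≡⟨ su-suc-suc n k ⟩
  su n k ℕ.+ n ℕ.* su n (suc k)
    ≡⟨ cong₂ (λ a b → a ℕ.+ n ℕ.* b) (su-vanishes n<k) (su-vanishes (ℕP.m<n⇒m<1+n n<k)) ⟩
  n ℕ.* 0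
    ≡⟨ ℕP.*-zeroʳ n ⟩
  0 ∎
  where open ≡-Reasoning

-- risingQuot x r = (x+1)(x+2)⋯(x+r−1) = x(x+1)⋯(x+r−1)/x for r ≥ 1,
-- and risingQuot′ x r is its derivative in x.
risingQuot : ℚ → ℕ → ℚ
risingQuot x r = sumTo r (λ t → ℕtoℚ (su r (suc t)) * x ^ t)

risingQuot′ : ℚ → ℕ → ℚ
risingQuot′ x r = sumTo (r ∸ 1) (λ k → ℕtoℚ (su r (suc (suc k))) * ℕtoℚ (suc k) * x ^ k)

risingQuot-+1 : ∀ x r → sumTo r (λ t → ℕtoℚ (su r (t ℕ.+ 1)) * x ^ t) ≡ risingQuot x r
risingQuot-+1 x r = sumTo-cong r (λ t _ → cong (λ k → ℕtoℚ (su r k) * x ^ t) (ℕP.+-comm t 1))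

ℕtoℚ-su-suc-suc : ∀ n k → ℕtoℚ (su (suc n) (suc k)) ≡ ℕtoℚ (su n k) + ℕtoℚ n * ℕtoℚ (su n (suc k))
ℕtoℚ-su-suc-suc n k =
  trans (cong ℕtoℚ (su-suc-suc n k))
        (trans (ℕtoℚ-+ (su n k) (n ℕ.* su n (suc k))) (cong (ℕtoℚ (su n k) +_) (ℕtoℚ-* n (su n (suc k)))))

risingQuot-suc : ∀ x n → risingQuot x (suc (suc n)) ≡ (x + ℕtoℚ (suc n)) * risingQuot x (suc n)
risingQuot-suc x n = begin
  sumTo (suc N) (λ t → ℕtoℚ (su (suc N) (suc t)) * x ^ t)
    ≡⟨ sumTo-cong (suc N) (λ t _ → split t) ⟩
  sumTo (suc N) (λ t → c t * x ^ t + ℕtoℚ N * (c (suc t) * x ^ t))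
    ≡⟨ sumTo-+ (suc N) _ _ ⟩
  sumTo (suc N) (λ t → c t * x ^ t) + sumTo (suc N) (λ t → ℕtoℚ N * (c (suc t) * x ^ t))
    ≡⟨ cong₂ _+_ (sumTo-head-vanishes N (cong (λ z → ℕtoℚ z * 1ℚ) (su-suc-zero n)))
                 (sym (sumTo-*ˡ (suc N) (ℕtoℚ N) _)) ⟩
  sumTo N (λ t → c (suc t) * (x * x ^ t)) + ℕtoℚ N * sumTo (suc N) (λ t → c (suc t) * x ^ t)
    ≡⟨ cong₂ (λ a b → a + ℕtoℚ N * b) (sumTo-cong N (λ t _ → pull (c (suc t)) x (x ^ t)))
                                      (sumTo-last-vanishes N top-vanishes) ⟩
  sumTo N (λ t → x * (c (suc t) * x ^ t)) + ℕtoℚ N * risingQuot x N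
    ≡⟨ cong (_+ ℕtoℚ N * risingQuot x N) (sumTo-*ˡ N x _) ⟨
  x * risingQuot x N + ℕtoℚ N * risingQuot x N
    ≡⟨ ℚP.*-distribʳ-+ (risingQuot x N) x (ℕtoℚ N) ⟨
  (x + ℕtoℚ N) * risingQuot x N ∎
  where
  open ≡-Reasoning
  open +-*-Solver
  N : ℕ
  N = suc n
  c : ℕ → ℚ
  c t = ℕtoℚ (su N t)
  split : ∀ t → ℕtoℚ (su (suc N) (suc t)) * x ^ t ≡ c t * x ^ t + ℕtoℚ N * (c (suc t) * x ^ t)
  split t = trans (cong (_* x ^ t) (ℕtoℚ-su-suc-suc N t)) (distrib (c t) (ℕtoℚ N) (c (suc t)) (x ^ t))
    where
    distrib : ∀ a n b p → (a + n * b) * p ≡ a * p + n * (b * p)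
    distrib = solve 4 (λ a n b p → (a :+ n :* b) :* p := a :* p :+ n :* (b :* p)) refl
  pull : ∀ a x p → a * (x * p) ≡ x * (a * p)
  pull = solve 3 (λ a x p → a :* (x :* p) := x :* (a :* p)) refl
  top-vanishes : c (suc N) * x ^ N ≡ 0ℚ
  top-vanishes = trans (cong (λ z → ℕtoℚ z * x ^ N) (su-vanishes (ℕP.n<1+n N))) (ℚP.*-zeroˡ (x ^ N))

risingQuot′-suc : ∀ x n →
  risingQuot′ x (suc (suc n)) ≡ risingQuot x (suc n) + (x + ℕtoℚ (suc n)) * risingQuot′ x (suc n)
risingQuot′-suc x n = begin
  sumTo N (λ k → ℕtoℚ (su (suc N) (suc (suc k))) * ℕtoℚ (suc k) * x ^ k)
    ≡⟨ sumTo-cong N (λ k _ → split k) ⟩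
  sumTo N (λ k → (c (suc k) * x ^ k + c (suc k) * ℕtoℚ k * x ^ k) + ℕtoℚ N * d k)
    ≡⟨ trans (sumTo-+ N _ _) (cong₂ _+_ (sumTo-+ N _ _) (sym (sumTo-*ˡ N (ℕtoℚ N) d))) ⟩
  (risingQuot x N + sumTo N (λ k → c (suc k) * ℕtoℚ k * x ^ k)) + ℕtoℚ N * sumTo N d
    ≡⟨ cong₂ (λ u v → (risingQuot x N + u) + ℕtoℚ N * v) lowered (sumTo-last-vanishes n top-vanishes) ⟩
  (risingQuot x N + x * risingQuot′ x N) + ℕtoℚ N * risingQuot′ x N
    ≡⟨ collect (risingQuot x N) x (ℕtoℚ N) (risingQuot′ x N) ⟩
  risingQuot x N + (x + ℕtoℚ N) * risingQuot′ x N ∎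
  where
  open ≡-Reasoning
  open +-*-Solver
  N : ℕ
  N = suc n
  c : ℕ → ℚ
  c t = ℕtoℚ (su N t)
  d : ℕ → ℚ
  d k = c (suc (suc k)) * ℕtoℚ (suc k) * x ^ k
  split : ∀ k → ℕtoℚ (su (suc N) (suc (suc k))) * ℕtoℚ (suc k) * x ^ k
              ≡ (c (suc k) * x ^ k + c (suc k) * ℕtoℚ k * x ^ k) + ℕtoℚ N * d k
  split k = begin
    ℕtoℚ (su (suc N) (suc (suc k))) * ℕtoℚ (suc k) * x ^ k
      ≡⟨ cong (λ a → a * ℕtoℚ (suc k) * x ^ k) (ℕtoℚ-su-suc-suc N (suc k)) ⟩
    (c (suc k) + ℕtoℚ N * c (suc (suc k))) * ℕtoℚ (suc k) * x ^ k
      ≡⟨ distrib (c (suc k)) (ℕtoℚ N) (c (suc (suc k))) (ℕtoℚ (suc k)) (x ^ k) ⟩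
    c (suc k) * ℕtoℚ (suc k) * x ^ k + ℕtoℚ N * d k
      ≡⟨ cong (λ s → c (suc k) * s * x ^ k + ℕtoℚ N * d k) (ℕtoℚ-suc k) ⟩
    c (suc k) * (1ℚ + ℕtoℚ k) * x ^ k + ℕtoℚ N * d k
      ≡⟨ cong (_+ ℕtoℚ N * d k) (expand (c (suc k)) (ℕtoℚ k) (x ^ k)) ⟩
    (c (suc k) * x ^ k + c (suc k) * ℕtoℚ k * x ^ k) + ℕtoℚ N * d k ∎
    where
    distrib : ∀ a n b s p → (a + n * b) * s * p ≡ a * s * p + n * (b * s * p)
    distrib = solve 5 (λ a n b s p → (a :+ n :* b) :* s :* p := a :* s :* p :+ n :* (b :* s :* p)) refl
    expand : ∀ a k p → a * (1ℚ + k) * p ≡ a * p + a * k * p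
    expand = solve 3 (λ a k p → a :* (con 1ℚ :+ k) :* p := a :* p :+ a :* k :* p) refl
  lowered : sumTo N (λ k → c (suc k) * ℕtoℚ k * x ^ k) ≡ x * risingQuot′ x N
  lowered = begin
    sumTo N (λ k → c (suc k) * ℕtoℚ k * x ^ k)
      ≡⟨ sumTo-head-vanishes n (trans (ℚP.*-identityʳ _) (ℚP.*-zeroʳ (c 1))) ⟩
    sumTo n (λ k → c (suc (suc k)) * ℕtoℚ (suc k) * (x * x ^ k))
      ≡⟨ sumTo-cong n (λ k _ → pull (c (suc (suc k))) (ℕtoℚ (suc k)) x (x ^ k)) ⟩
    sumTo n (λ k → x * d k)
      ≡⟨ sumTo-*ˡ n x d ⟨
    x * risingQuot′ x N ∎
    where
    pull : ∀ a b x p → a * b * (x * p) ≡ x * (a * b * p)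
    pull = solve 4 (λ a b x p → a :* b :* (x :* p) := x :* (a :* b :* p)) refl
  top-vanishes : d n ≡ 0ℚ
  top-vanishes = begin
    ℕtoℚ (su N (suc (suc n))) * ℕtoℚ (suc n) * x ^ n
      ≡⟨ cong (λ z → ℕtoℚ z * ℕtoℚ (suc n) * x ^ n) (su-vanishes (ℕP.n<1+n N)) ⟩
    0ℚ * ℕtoℚ (suc n) * x ^ n
      ≡⟨ trans (cong (_* x ^ n) (ℚP.*-zeroˡ (ℕtoℚ (suc n)))) (ℚP.*-zeroˡ (x ^ n)) ⟩
    0ℚ ∎
  collect : ∀ a x n b → (a + x * b) + n * b ≡ a + (x + n) * b
  collect = solve 4 (λ a x n b → (a :+ x :* b) :+ n :* b := a :+ (x :+ n) :* b) refl

nCk*[k!*[n∸k]!]≡n! : ∀ {n k} → k ≤ n → (n C k) ℕ.* (k ! ℕ.* (n ∸ k) !) ≡ n !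
nCk*[k!*[n∸k]!]≡n! {n} {k} k≤n = begin
  (n C k) ℕ.* (k ! ℕ.* (n ∸ k) !)
    ≡⟨ cong (ℕ._* (k ! ℕ.* (n ∸ k) !)) (ℕC.nCk≡n!/k![n-k]! k≤n) ⟩
  n ! / (k ! ℕ.* (n ∸ k) !) ℕ.* (k ! ℕ.* (n ∸ k) !)
    ≡⟨ m/n*n≡m (ℕC.k![n∸k]!∣n! k≤n) ⟩
  n ! ∎
  where
  open ≡-Reasoning
  instance _ = k ℕP.!* (n ∸ k) !≢0

risingQuot-*-! : ∀ m k → risingQuot (ℕtoℚ m) (suc k) * ℕtoℚ (m !) ≡ ℕtoℚ ((m ℕ.+ k) !)
risingQuot-*-! m zero    = trans (ℚP.*-identityˡ (ℕtoℚ (m !))) (cong (ℕtoℚ ∘ _!) (sym (ℕP.+-identityʳ m)))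
risingQuot-*-! m (suc k) = begin
  risingQuot (ℕtoℚ m) (suc (suc k)) * ℕtoℚ (m !)
    ≡⟨ cong (_* ℕtoℚ (m !)) (risingQuot-suc (ℕtoℚ m) k) ⟩
  (ℕtoℚ m + ℕtoℚ (suc k)) * risingQuot (ℕtoℚ m) (suc k) * ℕtoℚ (m !)
    ≡⟨ ℚP.*-assoc (ℕtoℚ m + ℕtoℚ (suc k)) (risingQuot (ℕtoℚ m) (suc k)) (ℕtoℚ (m !)) ⟩
  (ℕtoℚ m + ℕtoℚ (suc k)) * (risingQuot (ℕtoℚ m) (suc k) * ℕtoℚ (m !))
    ≡⟨ cong₂ _*_ (sym (ℕtoℚ-+ m (suc k))) (risingQuot-*-! m k) ⟩
  ℕtoℚ (m ℕ.+ suc k) * ℕtoℚ ((m ℕ.+ k) !)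
    ≡⟨ ℕtoℚ-* (m ℕ.+ suc k) ((m ℕ.+ k) !) ⟨
  ℕtoℚ ((m ℕ.+ suc k) ℕ.* (m ℕ.+ k) !)
    ≡⟨ cong (λ j → ℕtoℚ (j ℕ.* (m ℕ.+ k) !)) (ℕP.+-suc m k) ⟩
  ℕtoℚ (suc (m ℕ.+ k) !)
    ≡⟨ cong (ℕtoℚ ∘ _!) (ℕP.+-suc m k) ⟨
  ℕtoℚ ((m ℕ.+ suc k) !) ∎
  where open ≡-Reasoning

risingQuot-ℕ : ∀ m k → risingQuot (ℕtoℚ m) (suc k) ≡ ℕtoℚ ((m ℕ.+ k) C k) * ℕtoℚ (k !)
risingQuot-ℕ m k = *-cancelʳ-ℕtoℚ (m !) {{m ℕP.!≢0}} (begin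
  risingQuot (ℕtoℚ m) (suc k) * ℕtoℚ (m !)
    ≡⟨ risingQuot-*-! m k ⟩
  ℕtoℚ ((m ℕ.+ k) !)
    ≡⟨ cong ℕtoℚ (nCk*[k!*[n∸k]!]≡n! (ℕP.m≤n+m k m)) ⟨
  ℕtoℚ (B ℕ.* (k ! ℕ.* (m ℕ.+ k ∸ k) !))
    ≡⟨ cong (λ j → ℕtoℚ (B ℕ.* (k ! ℕ.* j !))) (ℕP.m+n∸n≡m m k) ⟩
  ℕtoℚ (B ℕ.* (k ! ℕ.* m !))
    ≡⟨ cong ℕtoℚ (ℕP.*-assoc B (k !) (m !)) ⟨
  ℕtoℚ (B ℕ.* k ! ℕ.* m !)
    ≡⟨ trans (ℕtoℚ-* (B ℕ.* k !) (m !)) (cong (_* ℕtoℚ (m !)) (ℕtoℚ-* B (k !))) ⟩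
  ℕtoℚ B * ℕtoℚ (k !) * ℕtoℚ (m !) ∎)
  where
  open ≡-Reasoning
  B : ℕ
  B = (m ℕ.+ k) C k

harmonic : ℕ → ℕ → ℚ
harmonic m k = sumTo k (λ i → inv (m ℕ.+ suc i))

risingQuot′≡risingQuot*harmonic : ∀ m k →
  risingQuot′ (ℕtoℚ m) (suc k) ≡ risingQuot (ℕtoℚ m) (suc k) * harmonic m k
risingQuot′≡risingQuot*harmonic m zero    = sym (ℚP.*-zeroʳ (risingQuot (ℕtoℚ m) 1))
risingQuot′≡risingQuot*harmonic m (suc k) = begin
  risingQuot′ x (suc (suc k))
    ≡⟨ risingQuot′-suc x k ⟩
  A + (x + K) * risingQuot′ x (suc k)
    ≡⟨ cong (λ z → A + (x + K) * z) (risingQuot′≡risingQuot*harmonic m k) ⟩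
  A + (x + K) * (A * H)
    ≡⟨ cong (λ z → z + (x + K) * (A * H)) (trans (sym (ℚP.*-identityʳ A)) (cong (A *_) (sym [x+K]*inv≡1))) ⟩
  A * ((x + K) * inv (m ℕ.+ suc k)) + (x + K) * (A * H)
    ≡⟨ regroup A (x + K) H (inv (m ℕ.+ suc k)) ⟩
  (x + K) * A * (H + inv (m ℕ.+ suc k))
    ≡⟨ cong (_* (H + inv (m ℕ.+ suc k))) (risingQuot-suc x k) ⟨
  risingQuot x (suc (suc k)) * harmonic m (suc k) ∎
  where
  open ≡-Reasoning
  open +-*-Solver
  x K A H : ℚ
  x = ℕtoℚ m
  K = ℕtoℚ (suc k)
  A = risingQuot x (suc k)
  H = harmonic m k
  [x+K]*inv≡1 : (x + K) * inv (m ℕ.+ suc k) ≡ 1ℚ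
  [x+K]*inv≡1 = begin
    (x + K) * inv (m ℕ.+ suc k)
      ≡⟨ cong (_* inv (m ℕ.+ suc k)) (ℕtoℚ-+ m (suc k)) ⟨
    ℕtoℚ (m ℕ.+ suc k) * inv (m ℕ.+ suc k)
      ≡⟨ ℚP.*-comm (ℕtoℚ (m ℕ.+ suc k)) (inv (m ℕ.+ suc k)) ⟩
    inv (m ℕ.+ suc k) * ℕtoℚ (m ℕ.+ suc k)
      ≡⟨ inv-*-ℕtoℚ (m ℕ.+ suc k) {{ℕ.≢-nonZero (ℕP.m+1+n≢0 m)}} ⟩
    1ℚ ∎
  regroup : ∀ a y h i → a * (y * i) + y * (a * h) ≡ y * a * (h + i)
  regroup = solve 4 (λ a y h i → a :* (y :* i) :+ y :* (a :* h) := y :* a :* (h :+ i)) refl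

a1-inner : ℕ → ℕ → ℕ → ℚ
a1-inner s n t₂ = sumRange t₂ (s ∸ 1) (λ k₂ →
  ℕtoℚ (su s (k₂ ℕ.+ 2)) * ℕtoℚ (k₂ ℕ.+ 1) * ℕtoℚ (k₂ C t₂) * negOnePow t₂ * ℕtoℚ (n ℕ.^ (k₂ ∸ t₂)))

a1-inner-generating : ∀ s {n ℓ} → ℓ ≤ n →
  sumTo (s ∸ 1) (λ t₂ → a1-inner s n t₂ * ℕtoℚ ℓ ^ t₂) ≡ risingQuot′ (ℕtoℚ (n ∸ ℓ)) s
a1-inner-generating s {n} {ℓ} ℓ≤n = begin
  sumTo M (λ j → a1-inner s n j * L ^ j)
    ≡⟨ sumTo-cong M (λ j _ → sumTo-*ʳ (M ∸ j) (λ i → Z (j ℕ.+ i) j) (L ^ j)) ⟩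
  sumTo M (λ j → sumRange j M (λ k → Z k j * L ^ j))
    ≡⟨ sumTo-sumRange-comm M (λ k j → Z k j * L ^ j) ⟩
  sumTo M (λ k → sumTo (suc k) (λ j → Z k j * L ^ j))
    ≡⟨ sumTo-cong M (λ k _ → expand k) ⟩
  sumTo M (λ k → W k * ℕtoℚ (n ∸ ℓ) ^ k)
    ≡⟨ sumTo-cong M (λ k _ → cong₂ (λ a b → ℕtoℚ (su s a) * ℕtoℚ b * ℕtoℚ (n ∸ ℓ) ^ k)
                                   (ℕP.+-comm k 2) (ℕP.+-comm k 1)) ⟩
  risingQuot′ (ℕtoℚ (n ∸ ℓ)) s ∎
  where
  open ≡-Reasoning
  M : ℕ
  M = s ∸ 1
  L : ℚ
  L = ℕtoℚ ℓ
  W : ℕ → ℚ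
  W k = ℕtoℚ (su s (k ℕ.+ 2)) * ℕtoℚ (k ℕ.+ 1)
  Z : ℕ → ℕ → ℚ
  Z k j = W k * ℕtoℚ (k C j) * negOnePow j * ℕtoℚ (n ℕ.^ (k ∸ j))
  binomialTerm : ∀ k j → Z k j * L ^ j ≡ W k * (ℕtoℚ (k C j) * ((- L) ^ j * ℕtoℚ n ^ (k ∸ j)))
  binomialTerm k j = begin
    W k * ℕtoℚ (k C j) * negOnePow j * ℕtoℚ (n ℕ.^ (k ∸ j)) * L ^ j
      ≡⟨ cong (λ p → W k * ℕtoℚ (k C j) * negOnePow j * p * L ^ j) (ℕtoℚ-^ n (k ∸ j)) ⟩
    W k * ℕtoℚ (k C j) * negOnePow j * ℕtoℚ n ^ (k ∸ j) * L ^ j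
      ≡⟨ regroup (W k) (ℕtoℚ (k C j)) (negOnePow j) (ℕtoℚ n ^ (k ∸ j)) (L ^ j) ⟩
    W k * (ℕtoℚ (k C j) * ((negOnePow j * L ^ j) * ℕtoℚ n ^ (k ∸ j)))
      ≡⟨ cong (λ q → W k * (ℕtoℚ (k C j) * (q * ℕtoℚ n ^ (k ∸ j)))) (negOnePow-*-^ j L) ⟩
    W k * (ℕtoℚ (k C j) * ((- L) ^ j * ℕtoℚ n ^ (k ∸ j))) ∎
    where
    open +-*-Solver
    regroup : ∀ w c ν p q → w * c * ν * p * q ≡ w * (c * ((ν * q) * p))
    regroup = solve 5 (λ w c ν p q → w :* c :* ν :* p :* q := w :* (c :* ((ν :* q) :* p))) refl
  expand : ∀ k → sumTo (suc k) (λ j → Z k j * L ^ j) ≡ W k * ℕtoℚ (n ∸ ℓ) ^ k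
  expand k = begin
    sumTo (suc k) (λ j → Z k j * L ^ j)
      ≡⟨ sumTo-cong (suc k) (λ j _ → binomialTerm k j) ⟩
    sumTo (suc k) (λ j → W k * (ℕtoℚ (k C j) * ((- L) ^ j * ℕtoℚ n ^ (k ∸ j))))
      ≡⟨ sumTo-*ˡ (suc k) (W k) _ ⟨
    W k * sumTo (suc k) (λ j → ℕtoℚ (k C j) * ((- L) ^ j * ℕtoℚ n ^ (k ∸ j)))
      ≡⟨ cong (W k *_) (binomial k (- L) (ℕtoℚ n)) ⟩
    W k * (- L + ℕtoℚ n) ^ k
      ≡⟨ cong (λ y → W k * y ^ k) (ℕtoℚ-∸ ℓ≤n) ⟩
    W k * ℕtoℚ (n ∸ ℓ) ^ k ∎

lemma4 : (r s n ℓ : ℕ) → 1 ≤ r → 1 ≤ s → 1 ≤ n → ℓ ≤ n →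
    ℕtoℚ ((ℓ Data.Nat.+ r ∸ 1) C (r ∸ 1)) * ℕtoℚ ((n ∸ ℓ Data.Nat.+ s ∸ 1) C (s ∸ 1))
      * sumRange 1 s (λ j → inv (n ∸ ℓ Data.Nat.+ j))
    ≡ sumRange 0 (r Data.Nat.+ s ∸ 2) (λ t → a1 r s n t * ℕtoℚ (ℓ Data.Nat.^ t))
lemma4 (suc r) (suc s) n ℓ _ _ _ ℓ≤n = sym (begin
  sumTo N (λ t → (c * G t) * ℕtoℚ (ℓ ℕ.^ t))
    ≡⟨ sumTo-cong N (λ t _ → trans (ℚP.*-assoc c (G t) _) (cong (λ y → c * (G t * y)) (ℕtoℚ-^ ℓ t))) ⟩
  sumTo N (λ t → c * (G t * L ^ t))
    ≡⟨ sumTo-*ˡ N c _ ⟨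
  c * sumTo N (λ t → G t * L ^ t)
    ≡⟨ cong (c *_) (sumTo-convolution N (suc r) s f (a1-inner (suc s) n) L degreeBound) ⟩
  c * (sumTo (suc r) (λ i → f i * L ^ i) * sumTo s (λ j → a1-inner (suc s) n j * L ^ j))
    ≡⟨ cong₂ (λ a b → c * (a * b)) (risingQuot-+1 L (suc r)) (a1-inner-generating (suc s) ℓ≤n) ⟩
  c * (risingQuot L (suc r) * risingQuot′ (ℕtoℚ m) (suc s))
    ≡⟨ cong (λ z → c * (risingQuot L (suc r) * z)) (risingQuot′≡risingQuot*harmonic m s) ⟩
  c * (risingQuot L (suc r) * (risingQuot (ℕtoℚ m) (suc s) * harmonic m s))
    ≡⟨ cong₂ (λ a b → c * (a * (b * harmonic m s))) (risingQuot-ℕ ℓ r) (risingQuot-ℕ m s) ⟩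
  c * ((Cℓ * ℕtoℚ (r !)) * ((Cm * ℕtoℚ (s !)) * harmonic m s))
    ≡⟨ inv-*-cancel (r !) (s !) {{r ℕP.!* s !≢0}} Cℓ Cm (harmonic m s) ⟩
  Cℓ * Cm * harmonic m s
    ≡⟨ cong₂ (λ a b → ℕtoℚ (a C r) * ℕtoℚ (b C s) * harmonic m s) (+-suc∸1 ℓ r) (+-suc∸1 m s) ⟨
  ℕtoℚ ((ℓ ℕ.+ suc r ∸ 1) C r) * ℕtoℚ ((m ℕ.+ suc s ∸ 1) C s) * harmonic m s ∎)
  where
  open ≡-Reasoning
  m N : ℕ
  m = n ∸ ℓ
  N = suc r ℕ.+ suc s ∸ 2
  L c : ℚ
  L = ℕtoℚ ℓ
  c = inv (r ! ℕ.* s !)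
  f : ℕ → ℚ
  f i = ℕtoℚ (su (suc r) (i ℕ.+ 1))
  G : ℕ → ℚ
  G t = sumTo (suc r) (λ i → sumTo s (λ j → ifEq (i ℕ.+ j) t (f i * a1-inner (suc s) n j)))
  Cℓ Cm : ℚ
  Cℓ = ℕtoℚ ((ℓ ℕ.+ r) C r)
  Cm = ℕtoℚ ((m ℕ.+ s) C s)
  +-suc∸1 : ∀ a b → a ℕ.+ suc b ∸ 1 ≡ a ℕ.+ b
  +-suc∸1 a b = cong (_∸ 1) (ℕP.+-suc a b)
  degreeBound : ∀ i j → i < suc r → j < s → i ℕ.+ j < N
  degreeBound i j (ℕ.s≤s i≤r) j<s = subst (i ℕ.+ j <_) (sym (+-suc∸1 r s)) (ℕP.+-mono-≤-< i≤r j<s)
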